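{- Let $f:\{\mathtt{1},\mathtt{2},\mathtt{3}\}^*\to\{\mathtt{1},\mathtt{2},\mathtt{3}\}^*$ be the $24$-uniform morphism defined by \begin{align*} \mathtt{1}&\mapsto \mathtt{123132312132123213231321},\\ \mathtt{2}&\mapsto \mathtt{231213123213231321312132},\\ \mathtt{3}&\mapsto \mathtt{312321231321312132123213}. \end{align*} Then the infinite word $f^\omega(\mathtt{1})$ (the fixed point of $f$ beginning with $\mathtt{1}$) is undirected $\tfrac{7}{4}^+$-free.
   Context: For a word $x=x_1x_2\cdots x_n$ (the $x_i$ letters), its reversal is $x^R=x_n\cdots x_2x_1$. For a rational number $1<r\le 2$, an undirected $r$-power is a word of the form $xyx'$ where $x$ is a nonempty word, $x'\in\{x,x^R\}$, and $|xyx'|/|xy|=r$. A (finite or infinite) word $w$ is undirected $\alpha^+$-free if no factor of $w$ is an undirected $r$-power for any $r>\alpha$. -}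

module Defs where

open import Data.Nat using (ℕ; zero; suc; _+_; _*_; _<_)
open import Data.List using (List; []; _∷_; _++_; length; reverse; concatMap)
open import Data.Product using (Σ; _×_; ∃; ∃-syntax)
open import Data.Sum using (_⊎_)
open import Relation.Binary.PropositionalEquality using (_≡_; _≢_)
open import Relation.Nullary using (¬_)

data Letter : Set where
  l1 l2 l3 : Letter

Word : Set
Word = List Letter

InfWord : Set → Set
InfWord A = ℕ → A

fL : Letter → Word
fL l1 = l1 ∷ l2 ∷ l3 ∷ l1 ∷ l3 ∷ l2 ∷ l3 ∷ l1 ∷ l2 ∷ l1 ∷ l3 ∷ l2 ∷ l1 ∷ l2 ∷ l3 ∷ l2 ∷ l1 ∷ l3 ∷ l2 ∷ l3 ∷ l1 ∷ l3 ∷ l2 ∷ l1 ∷ []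
fL l2 = l2 ∷ l3 ∷ l1 ∷ l2 ∷ l1 ∷ l3 ∷ l1 ∷ l2 ∷ l3 ∷ l2 ∷ l1 ∷ l3 ∷ l2 ∷ l3 ∷ l1 ∷ l3 ∷ l2 ∷ l1 ∷ l3 ∷ l1 ∷ l2 ∷ l1 ∷ l3 ∷ l2 ∷ []
fL l3 = l3 ∷ l1 ∷ l2 ∷ l3 ∷ l2 ∷ l1 ∷ l2 ∷ l3 ∷ l1 ∷ l3 ∷ l2 ∷ l1 ∷ l3 ∷ l1 ∷ l2 ∷ l1 ∷ l3 ∷ l2 ∷ l1 ∷ l2 ∷ l3 ∷ l2 ∷ l1 ∷ l3 ∷ []

f : Word → Word
f = concatMap fL

iterF : ℕ → Word → Word
iterF zero    u = u
iterF (suc n) u = f (iterF n u)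

nth : {A : Set} → A → List A → ℕ → A
nth d []       _       = d
nth d (a ∷ _)  zero    = a
nth d (_ ∷ as) (suc i) = nth d as i

-- The fixed point f^ω(1): its i-th letter is the i-th letter of f^(i+1)(1),
-- a word of length 24^(i+1) > i; each f^n(1) is a prefix of f^(n+1)(1).
fω1 : InfWord Letter
fω1 i = nth l1 (iterF (suc i) (l1 ∷ [])) i

factor : {A : Set} → InfWord A → ℕ → ℕ → List A
factor w i zero    = []
factor w i (suc n) = w i ∷ factor w (suc i) n

-- u is an undirected r-power xyx' (x nonempty, x' ∈ {x, x^R}) with
-- r = |xyx'| / |xy| > a / b, i.e. b * |xyx'| > a * |xy|.
UndirectedPowerAbove : {A : Set} → ℕ → ℕ → List A → Set
UndirectedPowerAbove {A} a b u =
  Σ (List A) λ x → Σ (List A) λ y → Σ (List A) λ x′ →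
    (x ≢ []) × ((x′ ≡ x) ⊎ (x′ ≡ reverse x)) × (u ≡ x ++ y ++ x′) ×
    (a * length (x ++ y) < b * length u)

UndirectedFreePlus : {A : Set} → ℕ → ℕ → InfWord A → Set
UndirectedFreePlus a b w = ∀ i n → ¬ UndirectedPowerAbove a b (factor w i n)

-- Let x y x′ be a factor of fω1 of exponent above 7/4, with |x| = m and |y| = g; then 3g < m.
-- If x′ = x, fω1 agrees with its shift by p = m + g on a window of length p + ⌊3p/4⌋ + 1;
-- if x′ is the reversal of x, a factor of length m reappears reversed at distance m + g.
-- Both are refuted through fω1 = f(fω1), which makes every window of fω1 a window of f(v)
-- for a short factor v of fω1; adjacent letters of v differ, so finitely many v cover all
-- cases. Short repetitions (p < 20, m < 19) are excluded by inspecting f(v) for all such v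
-- of length 3. For p ≥ 20 the window contains 16 agreeing letters, and a 16-letter factor of
-- fω1 determines its position modulo 24; so 24 divides p, and since the images of distinct
-- letters differ at every position, the repetition desubstitutes to one of period p/24,
-- which is excluded by induction on p. For m ≥ 19, x begins with a factor of length 19
-- whose reversal is also a factor, and inspecting f(u), f(v) for all u, v of length 2
-- shows that there is none.

module Submission where

open import Defs
open import Data.Bool using (Bool; true; false; _∧_; _∨_; not; T; if_then_else_)
open import Data.Bool.ListAction using (all; any)
open import Data.Bool.Properties using (T-∧; T-∨)
open import Data.List using (List; []; _∷_; _++_; length; reverse; upTo)
open import Data.List.Membership.Propositional using (find)
open import Data.List.Membership.Propositional.Properties using (∈-upTo⁺; ∈-upTo⁻)
open import Data.List.Properties using (∷-injective; unfold-reverse; length-reverse; length-++; ++-assoc; ++-identityʳ; concatMap-++)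
import Data.List.Relation.Unary.All as All
open import Data.List.Relation.Unary.All.Properties using (all⁺)
open import Data.List.Relation.Unary.Any.Properties using (any⁻)
open import Data.Nat hiding (_≟_)
import Data.Nat as ℕ
open import Data.Nat.DivMod using (_/_; _%_; m%n<n; m≡m%n+[m/n]*n)
open import Data.Nat.Divisibility using (_∣_; divides)
open import Data.Nat.Induction using (<-rec)
open import Data.Nat.Properties hiding (_≟_)
open import Data.Nat.Tactic.RingSolver using (solve-∀)
open import Data.Product using (_×_; _,_; proj₁; proj₂; ∃₂; ∃-syntax)
open import Data.Sum using (_⊎_; inj₁; inj₂; [_,_]′)
open import Data.Unit using (tt)
open import Function using (Equivalence; _∘_)
open import Relation.Binary.Definitions using (DecidableEquality)
open import Relation.Binary.PropositionalEquality using (_≡_; _≢_; refl; sym; trans; cong; cong₂; subst; subst₂; module ≡-Reasoning)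
open import Relation.Nullary using (¬_; yes; no; contradiction; ⌊_⌋)
open import Relation.Nullary.Decidable using (toWitness; toWitnessFalse; fromWitnessFalse)

module _ {A : Set} (d : A) where

  nth-++ˡ : ∀ (xs ys : List A) {k} → k < length xs → nth d (xs ++ ys) k ≡ nth d xs k
  nth-++ˡ (x ∷ xs) ys {zero}  _          = refl
  nth-++ˡ (x ∷ xs) ys {suc k} (s≤s k<xs) = nth-++ˡ xs ys k<xs

  nth-++ʳ : ∀ (xs ys : List A) k → nth d (xs ++ ys) (length xs + k) ≡ nth d ys k
  nth-++ʳ []       ys k = refl
  nth-++ʳ (x ∷ xs) ys k = nth-++ʳ xs ys k

  nth-reverse : ∀ (xs : List A) {a b} → suc (a + b) ≡ length xs → nth d (reverse xs) b ≡ nth d xs a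
  nth-reverse (x ∷ xs) {zero} {b} e rewrite unfold-reverse x xs = begin
    nth d (reverse xs ++ x ∷ []) b                         ≡⟨ cong (nth d (reverse xs ++ x ∷ [])) b≡ ⟩
    nth d (reverse xs ++ x ∷ []) (length (reverse xs) + 0) ≡⟨ nth-++ʳ (reverse xs) (x ∷ []) 0 ⟩
    x                                                      ∎
    where
    open ≡-Reasoning
    b≡ : b ≡ length (reverse xs) + 0
    b≡ = trans (suc-injective e) (sym (trans (+-identityʳ _) (length-reverse xs)))
  nth-reverse (x ∷ xs) {suc a} {b} e rewrite unfold-reverse x xs =
    trans (nth-++ˡ (reverse xs) (x ∷ []) b<) (nth-reverse xs (suc-injective e))
    where
    b< : b < length (reverse xs)
    b< = subst (b <_) (sym (trans (length-reverse xs) (sym (suc-injective e)))) (s≤s (m≤n+m b a))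

  nth-factor : ∀ (w : InfWord A) i n {k} → k < n → nth d (factor w i n) k ≡ w (i + k)
  nth-factor w i (suc n) {zero}  _         = cong w (sym (+-identityʳ i))
  nth-factor w i (suc n) {suc k} (s≤s k<n) = trans (nth-factor w (suc i) n k<n) (cong w (sym (+-suc i k)))

module _ {A : Set} (w : InfWord A) where

  length-factor : ∀ i n → length (factor w i n) ≡ n
  length-factor i zero    = refl
  length-factor i (suc n) = cong suc (length-factor (suc i) n)

  factor-++ : ∀ {i n} (x z : List A) → factor w i n ≡ x ++ z →
              x ≡ factor w i (length x) × z ≡ factor w (i + length x) (length z)
  factor-++ {i} {n}     []      z e =
    refl , trans (sym e) (cong₂ (factor w) (sym (+-identityʳ i)) (trans (sym (length-factor i n)) (cong length e)))
  factor-++ {i} {suc n} (a ∷ x) z e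
    with refl , e′ ← ∷-injective e
    with x≡ , z≡ ← factor-++ x z e′ =
    cong (w i ∷_) x≡ , trans z≡ (cong (λ j → factor w j (length z)) (sym (+-suc i (length x))))

  factor-agree : ∀ {i j l k} → factor w i l ≡ factor w j l → k < l → w (i + k) ≡ w (j + k)
  factor-agree {i} {j} {l} {k} e k<l = begin
    w (i + k)                   ≡⟨ nth-factor (w i) w i l k<l ⟨
    nth (w i) (factor w i l) k  ≡⟨ cong (λ u → nth (w i) u k) e ⟩
    nth (w i) (factor w j l) k  ≡⟨ nth-factor (w i) w j l k<l ⟩
    w (j + k)                   ∎
    where open ≡-Reasoning

  power-copies : ∀ {i n} (x y x′ : List A) → factor w i n ≡ x ++ y ++ x′ → length x′ ≡ length x →
                 x ≡ factor w i (length x) × x′ ≡ factor w (i + length x + length y) (length x)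
  power-copies x y x′ e |x′|≡|x|
    with x≡ , yx′≡ ← factor-++ x (y ++ x′) e
    with _ , x′≡ ← factor-++ y x′ (sym yx′≡) = x≡ , trans x′≡ (cong (factor w _) |x′|≡|x|)

module _ {A : Set} (w : InfWord A) where

  DirectRepetition : ℕ → ℕ → Set
  DirectRepetition p i = ∀ {k} → 4 * k ≤ 3 * p → w (i + k) ≡ w (i + p + k)

  Mirror : ℕ → ℕ → ℕ → Set
  Mirror i j m = ∀ {a b} → suc (a + b) ≡ m → w (i + a) ≡ w (j + b)

  Repetition : ℕ → Set
  Repetition i = (∃[ p ] 0 < p × DirectRepetition p i) ⊎ (∃₂ λ m g → 3 * g < m × Mirror i (i + m + g) m)

  factor-mirror : ∀ {i j m} → factor w j m ≡ reverse (factor w i m) → Mirror i j m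
  factor-mirror {i} {j} {m} e {a} {b} 1+a+b≡m = begin
    w (i + a)                             ≡⟨ nth-factor (w i) w i m a<m ⟨
    nth (w i) (factor w i m) a            ≡⟨ nth-reverse (w i) (factor w i m) (trans 1+a+b≡m (sym (length-factor w i m))) ⟨
    nth (w i) (reverse (factor w i m)) b  ≡⟨ cong (λ u → nth (w i) u b) e ⟨
    nth (w i) (factor w j m) b            ≡⟨ nth-factor (w i) w j m b<m ⟩
    w (j + b)                             ∎
    where
    open ≡-Reasoning
    a<m : a < m
    a<m = subst (a <_) 1+a+b≡m (s≤s (m≤m+n a b))
    b<m : b < m
    b<m = subst (b <_) 1+a+b≡m (s≤s (m≤n+m b a))

  Mirror-shrink : ∀ {i j n l} → Mirror i j (n + l) → Mirror i (j + l) n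
  Mirror-shrink {i} {j} {n} {l} mirror {a} {b} 1+a+b≡n =
    trans (mirror (trans (regroup a b l) (cong (_+ l) 1+a+b≡n))) (cong w (sym (+-assoc j l b)))
    where
    regroup : ∀ a b l → suc (a + (l + b)) ≡ suc (a + b) + l
    regroup = solve-∀

seven-quarters : ∀ m g → 7 * (m + g) < 4 * (m + (g + m)) → 3 * g < m
seven-quarters m g long = +-cancelˡ-< (7 * m + 4 * g) (3 * g) m (subst₂ _<_ (lhs m g) (rhs m g) long)
  where
  lhs : ∀ m g → 7 * (m + g) ≡ 7 * m + 4 * g + 3 * g
  lhs = solve-∀
  rhs : ∀ m g → 4 * (m + (g + m)) ≡ 7 * m + 4 * g + m
  rhs = solve-∀

period-bound : ∀ {m g k} → 3 * g < m → 4 * k ≤ 3 * (m + g) → k < m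
period-bound {m} {g} {k} 3g<m 4k≤ = *-cancelˡ-< 4 k m (≤-<-trans 4k≤ (begin-strict
  3 * (m + g)    ≡⟨ *-distribˡ-+ 3 m g ⟩
  3 * m + 3 * g  <⟨ +-monoʳ-< (3 * m) 3g<m ⟩
  3 * m + m      ≡⟨ +-comm (3 * m) m ⟩
  4 * m          ∎))
  where open ≤-Reasoning

power⇒repetition : ∀ {A : Set} (w : InfWord A) {i n} → UndirectedPowerAbove 7 4 (factor w i n) → Repetition w i
power⇒repetition w ([] , _ , _ , []≢[] , _) = contradiction refl []≢[]
power⇒repetition w {i} {n} (x@(_ ∷ _) , y , x′ , _ , x′≡x⊎xᴿ , e , long) = repetition x′≡x⊎xᴿ
  where
  open ≡-Reasoning
  m g : ℕ
  m = length x
  g = length y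
  |x′|≡m : length x′ ≡ m
  |x′|≡m = [ cong length , (λ x′≡xᴿ → trans (cong length x′≡xᴿ) (length-reverse x)) ]′ x′≡x⊎xᴿ
  |u|≡ : length (factor w i n) ≡ m + (g + m)
  |u|≡ = begin
    length (factor w i n)   ≡⟨ cong length e ⟩
    length (x ++ y ++ x′)   ≡⟨ length-++ x ⟩
    m + length (y ++ x′)    ≡⟨ cong (m +_) (length-++ y) ⟩
    m + (g + length x′)     ≡⟨ cong (λ l → m + (g + l)) |x′|≡m ⟩
    m + (g + m)             ∎
  3g<m : 3 * g < m
  3g<m = seven-quarters m g (subst₂ _<_ (cong (7 *_) (length-++ x)) (cong (4 *_) |u|≡) long)
  copies : x ≡ factor w i m × x′ ≡ factor w (i + m + g) m
  copies = power-copies w x y x′ e |x′|≡m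
  repetition : x′ ≡ x ⊎ x′ ≡ reverse x → Repetition w i
  repetition (inj₁ x′≡x) = inj₁ (m + g , s≤s z≤n , λ {k} 4k≤ → begin
    w (i + k)             ≡⟨ factor-agree w x≡x′ (period-bound 3g<m 4k≤) ⟩
    w (i + m + g + k)     ≡⟨ cong (λ j → w (j + k)) (+-assoc i m g) ⟩
    w (i + (m + g) + k)   ∎)
    where
    x≡x′ : factor w i m ≡ factor w (i + m + g) m
    x≡x′ = trans (sym (proj₁ copies)) (trans (sym x′≡x) (proj₂ copies))
  repetition (inj₂ x′≡xᴿ) =
    inj₂ (m , g , 3g<m , factor-mirror w x′≡xᴿ′)
    where
    x′≡xᴿ′ : factor w (i + m + g) m ≡ reverse (factor w i m)
    x′≡xᴿ′ = trans (sym (proj₂ copies)) (trans x′≡xᴿ (cong reverse (proj₁ copies)))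

-- The morphism and its fixed point

length-fL : ∀ a → length (fL a) ≡ 24
length-fL l1 = refl
length-fL l2 = refl
length-fL l3 = refl

length-f : ∀ u → length (f u) ≡ length u * 24
length-f []      = refl
length-f (a ∷ u) = trans (length-++ (fL a)) (cong₂ _+_ (length-fL a) (length-f u))

nth-fL-++ˡ : ∀ a v {j} → j < 24 → nth l1 (fL a ++ v) j ≡ nth l1 (fL a) j
nth-fL-++ˡ a v j<24 = nth-++ˡ l1 (fL a) v (subst (_ <_) (sym (length-fL a)) j<24)

nth-fL-++ʳ : ∀ a v j → nth l1 (fL a ++ v) (24 + j) ≡ nth l1 v j
nth-fL-++ʳ a v j = subst (λ n → nth l1 (fL a ++ v) (n + j) ≡ nth l1 v j) (length-fL a) (nth-++ʳ l1 (fL a) v j)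

nth-f : ∀ u {t j} → t < length u → j < 24 → nth l1 (f u) (t * 24 + j) ≡ nth l1 (fL (nth l1 u t)) j
nth-f (a ∷ u) {zero}      _         j<24 = nth-fL-++ˡ a (f u) j<24
nth-f (a ∷ u) {suc t} {j} (s≤s t<u) j<24 = begin
  nth l1 (fL a ++ f u) (24 + t * 24 + j)    ≡⟨ cong (nth l1 (fL a ++ f u)) (+-assoc 24 (t * 24) j) ⟩
  nth l1 (fL a ++ f u) (24 + (t * 24 + j))  ≡⟨ nth-fL-++ʳ a (f u) (t * 24 + j) ⟩
  nth l1 (f u) (t * 24 + j)                 ≡⟨ nth-f u t<u j<24 ⟩
  nth l1 (fL (nth l1 u t)) j                ∎
  where open ≡-Reasoning

fL-head : ∀ a → nth l1 (fL a) 0 ≡ a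
fL-head l1 = refl
fL-head l2 = refl
fL-head l3 = refl

fL-last : ∀ a → nth l1 (fL a) 23 ≡ a
fL-last l1 = refl
fL-last l2 = refl
fL-last l3 = refl

seed : Word
seed = l1 ∷ []

iterF-suc-prefix : ∀ n → ∃[ z ] iterF (suc n) seed ≡ iterF n seed ++ z
iterF-suc-prefix zero    = _ , refl
iterF-suc-prefix (suc n) with z , e ← iterF-suc-prefix n = f z , trans (cong f e) (concatMap-++ fL (iterF n seed) z)

iterF-prefix : ∀ {m n} → m ≤′ n → ∃[ z ] iterF n seed ≡ iterF m seed ++ z
iterF-prefix ≤′-refl = [] , sym (++-identityʳ _)
iterF-prefix {m} (≤′-step {n} m≤n)
  with z , e ← iterF-prefix m≤n
  with z′ , e′ ← iterF-suc-prefix n = z ++ z′ , (begin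
    iterF (suc n) seed          ≡⟨ e′ ⟩
    iterF n seed ++ z′          ≡⟨ cong (_++ z′) e ⟩
    (iterF m seed ++ z) ++ z′   ≡⟨ ++-assoc (iterF m seed) z z′ ⟩
    iterF m seed ++ z ++ z′     ∎)
  where open ≡-Reasoning

n<length-iterF : ∀ n → n < length (iterF n seed)
n<length-iterF zero    = s≤s z≤n
n<length-iterF (suc n) = subst (suc n <_) (sym (length-f (iterF n seed))) (grow (n<length-iterF n))
  where
  grow : ∀ {L} → n < L → suc n < L * 24
  grow {suc L} (s≤s n≤L) = s≤s (s≤s (≤-trans n≤L (≤-trans (m≤m*n L 24) (m≤n+m (L * 24) 22))))

iterF-stable : ∀ {m n i} → m ≤ n → i < length (iterF m seed) → nth l1 (iterF n seed) i ≡ nth l1 (iterF m seed) i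
iterF-stable {m} {n} {i} m≤n i<
  with z , e ← iterF-prefix (≤⇒≤′ m≤n) = trans (cong (λ u → nth l1 u i) e) (nth-++ˡ l1 (iterF m seed) z i<)

nth-iterF : ∀ n {i} → i < length (iterF n seed) → nth l1 (iterF n seed) i ≡ fω1 i
nth-iterF n {i} i< with ≤-total n (suc i)
... | inj₁ n≤1+i = sym (iterF-stable n≤1+i i<)
... | inj₂ 1+i≤n = iterF-stable 1+i≤n (<-trans (n<1+n i) (n<length-iterF (suc i)))

block-in-range : ∀ {t j L} → t < L → j < 24 → t * 24 + j < L * 24
block-in-range {t} {j} {L} t<L j<24 = begin-strict
  t * 24 + j    <⟨ +-monoʳ-< (t * 24) j<24 ⟩
  t * 24 + 24   ≡⟨ +-comm (t * 24) 24 ⟩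
  suc t * 24    ≤⟨ *-monoˡ-≤ 24 t<L ⟩
  L * 24        ∎
  where open ≤-Reasoning

fω1-block : ∀ t {j} → j < 24 → fω1 (t * 24 + j) ≡ nth l1 (fL (fω1 t)) j
fω1-block t {j} j<24 = begin
  fω1 (t * 24 + j)                               ≡⟨ nth-iterF (suc (suc t)) in-range ⟨
  nth l1 (f (iterF (suc t) seed)) (t * 24 + j)   ≡⟨ nth-f (iterF (suc t) seed) t< j<24 ⟩
  nth l1 (fL (fω1 t)) j                          ∎
  where
  open ≡-Reasoning
  t< : t < length (iterF (suc t) seed)
  t< = <-trans (n<1+n t) (n<length-iterF (suc t))
  in-range : t * 24 + j < length (f (iterF (suc t) seed))
  in-range = subst (t * 24 + j <_) (sym (length-f (iterF (suc t) seed))) (block-in-range t< j<24)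

<-or-offset : ∀ m k → k < m ⊎ ∃[ j ] k ≡ m + j
<-or-offset m k with k <? m
... | yes k<m = inj₁ k<m
... | no k≮m  = inj₂ (k ∸ m , sym (m+[n∸m]≡n (≮⇒≥ k≮m)))

fω1-window : ∀ t n {k} → k < n * 24 → fω1 (t * 24 + k) ≡ nth l1 (f (factor fω1 t n)) k
fω1-window t (suc n) {k} k< with <-or-offset 24 k
... | inj₁ k<24 = trans (fω1-block t k<24) (sym (nth-fL-++ˡ (fω1 t) _ k<24))
... | inj₂ (j , refl) = begin
  fω1 (t * 24 + (24 + j))                      ≡⟨ cong fω1 (shift t j) ⟩
  fω1 (suc t * 24 + j)                         ≡⟨ fω1-window (suc t) n (+-cancelˡ-< 24 j (n * 24) k<) ⟩
  nth l1 (f (factor fω1 (suc t) n)) j          ≡⟨ nth-fL-++ʳ (fω1 t) _ j ⟨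
  nth l1 (f (factor fω1 t (suc n))) (24 + j)   ∎
  where
  open ≡-Reasoning
  shift : ∀ t j → t * 24 + (24 + j) ≡ suc t * 24 + j
  shift = solve-∀

divMod24 : ∀ i → ∃₂ λ t r → r < 24 × t * 24 + r ≡ i
divMod24 i = i / 24 , i % 24 , m%n<n i 24 , trans (+-comm (i / 24 * 24) (i % 24)) (sym (m≡m%n+[m/n]*n i 24))

-- Finite inspection by evaluation

_≟_ : DecidableEquality Letter
l1 ≟ l1 = yes refl
l2 ≟ l2 = yes refl
l3 ≟ l3 = yes refl
l1 ≟ l2 = no λ ()
l1 ≟ l3 = no λ ()
l2 ≟ l1 = no λ ()
l2 ≟ l3 = no λ ()
l3 ≟ l1 = no λ ()
l3 ≟ l2 = no λ ()

letterDiffers : Letter → Word → ℕ → Bool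
letterDiffers a []      _       = false
letterDiffers a (b ∷ v) zero    = not ⌊ a ≟ b ⌋
letterDiffers a (_ ∷ v) (suc j) = letterDiffers a v j

differ : Word → ℕ → Word → ℕ → Bool
differ []      _       v j = false
differ (a ∷ u) zero    v j = letterDiffers a v j
differ (_ ∷ u) (suc i) v j = differ u i v j

letterDiffers-sound : ∀ a v j → T (letterDiffers a v j) → j < length v × a ≢ nth l1 v j
letterDiffers-sound a (b ∷ v) zero    h = s≤s z≤n , toWitnessFalse h
letterDiffers-sound a (_ ∷ v) (suc j) h with j< , a≢ ← letterDiffers-sound a v j h = s≤s j< , a≢

differ-sound : ∀ u i v j → T (differ u i v j) → i < length u × j < length v × nth l1 u i ≢ nth l1 v j
differ-sound (a ∷ u) zero    v j h = s≤s z≤n , letterDiffers-sound a v j h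
differ-sound (_ ∷ u) (suc i) v j h with i< , rest ← differ-sound u i v j h = s≤s i< , rest

all-upTo-sound : ∀ (p : ℕ → Bool) n → T (all p (upTo n)) → ∀ {k} → k < n → T (p k)
all-upTo-sound p n h k<n = All.lookup (all⁺ p (upTo n) h) (∈-upTo⁺ k<n)

any-upTo-sound : ∀ (p : ℕ → Bool) n → T (any p (upTo n)) → ∃[ k ] k < n × T (p k)
any-upTo-sound p n h with k , k∈ , pk ← find (any⁻ p (upTo n) h) = k , ∈-upTo⁻ k∈ , pk

allLetters : (Letter → Bool) → Bool
allLetters P = P l1 ∧ P l2 ∧ P l3

allLetters-sound : ∀ P → T (allLetters P) → ∀ a → T (P a)
allLetters-sound P h l1 = proj₁ (Equivalence.to (T-∧ {P l1}) h)
allLetters-sound P h l2 = proj₁ (Equivalence.to (T-∧ {P l2}) (proj₂ (Equivalence.to (T-∧ {P l1}) h)))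
allLetters-sound P h l3 = proj₂ (Equivalence.to (T-∧ {P l2}) (proj₂ (Equivalence.to (T-∧ {P l1}) h)))

allWords : ℕ → (Word → Bool) → Bool
allWords zero    P = P []
allWords (suc n) P = allLetters λ a → allWords n (P ∘ (a ∷_))

allWords-sound : ∀ n P → T (allWords n P) → ∀ v → length v ≡ n → T (P v)
allWords-sound zero    P h []      _     = h
allWords-sound (suc n) P h (a ∷ v) |v|≡n =
  allWords-sound n (P ∘ (a ∷_)) (allLetters-sound (λ a → allWords n (P ∘ (a ∷_))) h a) v (suc-injective |v|≡n)

distinctNeighbours : Word → Bool
distinctNeighbours (a ∷ b ∷ v) = not ⌊ a ≟ b ⌋ ∧ distinctNeighbours (b ∷ v)
distinctNeighbours _           = true

allDistinctNeighbours : ℕ → (Word → Bool) → Bool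
allDistinctNeighbours n P = allWords n λ v → if distinctNeighbours v then P v else true

neighboursDiffer : Word → ℕ → Bool
neighboursDiffer u j = differ u j u (suc j)

fL-neighbours-differ : T (allLetters λ a → all (neighboursDiffer (fL a)) (upTo 23))
fL-neighbours-differ = tt

fL-distinct-neighbours : ∀ a {j} → j < 23 → nth l1 (fL a) j ≢ nth l1 (fL a) (suc j)
fL-distinct-neighbours a {j} j<23 = proj₂ (proj₂ (differ-sound (fL a) j (fL a) (suc j)
  (all-upTo-sound (neighboursDiffer (fL a)) 23
    (allLetters-sound (λ a → all (neighboursDiffer (fL a)) (upTo 23)) fL-neighbours-differ a) j<23)))

fω1-distinct-neighbours : ∀ t → fω1 t ≢ fω1 (suc t)
fω1-distinct-neighbours = <-rec _ step
  where
  open ≡-Reasoning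
  next-block : ∀ t → suc (t * 24 + 23) ≡ suc t * 24 + 0
  next-block = solve-∀
  step : ∀ i → (∀ {t} → t < i → fω1 t ≢ fω1 (suc t)) → fω1 i ≢ fω1 (suc i)
  step i rec with t , r , r<24 , refl ← divMod24 i with m≤n⇒m<n∨m≡n (≤-pred r<24)
  ... | inj₁ r<23 = λ same → fL-distinct-neighbours (fω1 t) r<23 (begin
    nth l1 (fL (fω1 t)) r         ≡⟨ fω1-block t r<24 ⟨
    fω1 (t * 24 + r)              ≡⟨ same ⟩
    fω1 (suc (t * 24 + r))        ≡⟨ cong fω1 (+-suc (t * 24) r) ⟨
    fω1 (t * 24 + suc r)          ≡⟨ fω1-block t (s≤s r<23) ⟩
    nth l1 (fL (fω1 t)) (suc r)   ∎)
  ... | inj₂ refl = λ same → rec (≤-<-trans (m≤m*n t 24) (m<m+n (t * 24) (s≤s z≤n))) (begin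
    fω1 t                            ≡⟨ fL-last (fω1 t) ⟨
    nth l1 (fL (fω1 t)) 23           ≡⟨ fω1-block t r<24 ⟨
    fω1 (t * 24 + 23)                ≡⟨ same ⟩
    fω1 (suc (t * 24 + 23))          ≡⟨ cong fω1 (next-block t) ⟩
    fω1 (suc t * 24 + 0)             ≡⟨ fω1-block (suc t) (s≤s z≤n) ⟩
    nth l1 (fL (fω1 (suc t))) 0      ≡⟨ fL-head (fω1 (suc t)) ⟩
    fω1 (suc t)                      ∎)

factor-distinctNeighbours : ∀ t n → T (distinctNeighbours (factor fω1 t n))
factor-distinctNeighbours t zero          = tt
factor-distinctNeighbours t (suc zero)    = tt
factor-distinctNeighbours t (suc (suc n)) = Equivalence.from T-∧
  (fromWitnessFalse (fω1-distinct-neighbours t) , factor-distinctNeighbours (suc t) (suc n))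

allDistinctNeighbours-factor : ∀ n P → T (allDistinctNeighbours n P) → ∀ t → T (P (factor fω1 t n))
allDistinctNeighbours-factor n P h t = if-true (distinctNeighbours v)
  (allWords-sound n (λ v → if distinctNeighbours v then P v else true) h v (length-factor fω1 t n))
  (factor-distinctNeighbours t n)
  where
  v : Word
  v = factor fω1 t n
  if-true : ∀ b {x} → T (if b then x else true) → T b → T x
  if-true true h _ = h

mismatch : ∀ t n t′ n′ {r r′ i i′} → t * 24 + r ≡ i → t′ * 24 + r′ ≡ i′ →
           T (differ (f (factor fω1 t n)) r (f (factor fω1 t′ n′)) r′) → fω1 i ≢ fω1 i′
mismatch t n t′ n′ {r} {r′} refl refl differs same =
  let r< , r′< , letters≢ = differ-sound (f (factor fω1 t n)) r (f (factor fω1 t′ n′)) r′ differs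
  in letters≢ (begin
    nth l1 (f (factor fω1 t n)) r      ≡⟨ fω1-window t n (in-window t n r<) ⟨
    fω1 (t * 24 + r)                   ≡⟨ same ⟩
    fω1 (t′ * 24 + r′)                 ≡⟨ fω1-window t′ n′ (in-window t′ n′ r′<) ⟩
    nth l1 (f (factor fω1 t′ n′)) r′   ∎)
  where
  open ≡-Reasoning
  in-window : ∀ t n {k} → k < length (f (factor fω1 t n)) → k < n * 24
  in-window t n {k} = subst (k <_) (trans (length-f (factor fω1 t n)) (cong (_* 24) (length-factor fω1 t n)))

imagesApart : Letter → Letter → Bool
imagesApart a b = all (λ j → differ (fL a) j (fL b) j) (upTo 24)

fL-images-apart : T (allLetters λ a → allLetters λ b → ⌊ a ≟ b ⌋ ∨ imagesApart a b)
fL-images-apart = tt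

fL-injective-at : ∀ {a b j} → j < 24 → nth l1 (fL a) j ≡ nth l1 (fL b) j → a ≡ b
fL-injective-at {a} {b} {j} j<24 same =
  [ toWitness
  , (λ apart → contradiction same (proj₂ (proj₂ (differ-sound (fL a) j (fL b) j
      (all-upTo-sound (λ j → differ (fL a) j (fL b) j) 24 apart j<24)))))
  ]′ (Equivalence.to (T-∨ {⌊ a ≟ b ⌋}) (allLetters-sound (λ b → ⌊ a ≟ b ⌋ ∨ imagesApart a b)
       (allLetters-sound (λ a → allLetters λ b → ⌊ a ≟ b ⌋ ∨ imagesApart a b) fL-images-apart a) b))

-- Direct repetitions

desubstitute : ∀ q t {r} → r < 24 → DirectRepetition fω1 (q * 24) (t * 24 + r) → DirectRepetition fω1 q t
desubstitute q t {r} r<24 rep {s} 4s≤3q = fL-injective-at r<24 (begin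
  nth l1 (fL (fω1 (t + s))) r            ≡⟨ fω1-block (t + s) r<24 ⟨
  fω1 ((t + s) * 24 + r)                 ≡⟨ cong fω1 (regroupˡ t s r) ⟩
  fω1 (t * 24 + r + s * 24)              ≡⟨ rep (subst₂ _≤_ (*-assoc 4 s 24) (*-assoc 3 q 24) (*-monoˡ-≤ 24 4s≤3q)) ⟩
  fω1 (t * 24 + r + q * 24 + s * 24)     ≡⟨ cong fω1 (regroupʳ t q s r) ⟩
  fω1 ((t + q + s) * 24 + r)             ≡⟨ fω1-block (t + q + s) r<24 ⟩
  nth l1 (fL (fω1 (t + q + s))) r        ∎)
  where
  open ≡-Reasoning
  regroupˡ : ∀ t s r → (t + s) * 24 + r ≡ t * 24 + r + s * 24
  regroupˡ = solve-∀
  regroupʳ : ∀ t q s r → t * 24 + r + q * 24 + s * 24 ≡ (t + q + s) * 24 + r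
  regroupʳ = solve-∀

periodBroken : Word → ℕ → ℕ → ℕ → Bool
periodBroken L r p k = (4 * k ≤ᵇ 3 * p) ∧ differ L (r + k) L (r + p + k)

shortPeriodsBroken : Word → Bool
shortPeriodsBroken L = all (λ r → all (λ p → any (periodBroken L r (suc p)) (upTo 15)) (upTo 19)) (upTo 24)

short-periods-broken : T (allDistinctNeighbours 3 (shortPeriodsBroken ∘ f))
short-periods-broken = tt

short-period-broken : ∀ t {r p} → r < 24 → p < 19 →
                      ∃[ k ] k < 15 × T (periodBroken (f (factor fω1 t 3)) r (suc p) k)
short-period-broken t {r} {p} r<24 p<19 =
  any-upTo-sound (periodBroken L r (suc p)) 15
    (all-upTo-sound (λ p → any (periodBroken L r (suc p)) (upTo 15)) 19
      (all-upTo-sound (λ r → all (λ p → any (periodBroken L r (suc p)) (upTo 15)) (upTo 19)) 24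
        (allDistinctNeighbours-factor 3 (shortPeriodsBroken ∘ f) short-periods-broken t) r<24) p<19)
  where
  L : Word
  L = f (factor fω1 t 3)

no-short-direct-repetition : ∀ {p} i → 0 < p → p < 20 → ¬ DirectRepetition fω1 p i
no-short-direct-repetition {suc p} i _ (s≤s p<19) rep with t , r , r<24 , refl ← divMod24 i =
  let k , _ , broken     = short-period-broken t r<24 p<19
      in-range , differs = Equivalence.to (T-∧ {4 * k ≤ᵇ 3 * suc p}) broken
  in mismatch t 3 t 3 (sym (+-assoc (t * 24) r k)) (regroup (t * 24) r (suc p) k) differs
       (rep {k} (≤ᵇ⇒≤ (4 * k) (3 * suc p) in-range))
  where
  regroup : ∀ a b c d → a + (b + c + d) ≡ a + b + c + d
  regroup = solve-∀

synchronisedAt : Word → Word → ℕ → ℕ → Bool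
synchronisedAt L L′ r r′ = ⌊ r ℕ.≟ r′ ⌋ ∨ any (λ k → differ L (r + k) L′ (r′ + k)) (upTo 16)

synchronising : Word → Word → Bool
synchronising L L′ = all (λ r → all (synchronisedAt L L′ r) (upTo 24)) (upTo 24)

f-synchronising : T (allDistinctNeighbours 2 λ u → allDistinctNeighbours 2 λ v → synchronising (f u) (f v))
f-synchronising = tt

windows-synchronised : ∀ t t′ {r r′} → r < 24 → r′ < 24 →
  r ≡ r′ ⊎ ∃[ k ] k < 16 × T (differ (f (factor fω1 t 2)) (r + k) (f (factor fω1 t′ 2)) (r′ + k))
windows-synchronised t t′ {r} {r′} r<24 r′<24 =
  [ inj₁ ∘ toWitness {a? = r ℕ.≟ r′} , inj₂ ∘ any-upTo-sound (λ k → differ L (r + k) L′ (r′ + k)) 16 ]′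
    (Equivalence.to (T-∨ {⌊ r ℕ.≟ r′ ⌋}) (all-upTo-sound (synchronisedAt L L′ r) 24
      (all-upTo-sound (λ r → all (synchronisedAt L L′ r) (upTo 24)) 24
        (allDistinctNeighbours-factor 2 (synchronising L ∘ f)
          (allDistinctNeighbours-factor 2 (λ u → allDistinctNeighbours 2 λ v → synchronising (f u) (f v))
            f-synchronising t) t′) r<24) r′<24))
  where
  L L′ : Word
  L = f (factor fω1 t 2)
  L′ = f (factor fω1 t′ 2)

block-shift : ∀ {t t′ r p} → t′ * 24 + r ≡ t * 24 + r + p → 24 ∣ p
block-shift {t} {t′} {r} {p} e = divides (t′ ∸ t) (begin
  p                         ≡⟨ m+n∸m≡n (t * 24) p ⟨
  t * 24 + p ∸ t * 24       ≡⟨ cong (_∸ t * 24) (+-cancelʳ-≡ r (t * 24 + p) (t′ * 24) (trans (swap (t * 24) p r) (sym e))) ⟩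
  t′ * 24 ∸ t * 24          ≡⟨ *-distribʳ-∸ 24 t′ t ⟨
  (t′ ∸ t) * 24             ∎)
  where
  open ≡-Reasoning
  swap : ∀ a b c → a + b + c ≡ a + c + b
  swap = solve-∀

synchronised : ∀ i p → (∀ {k} → k < 16 → fω1 (i + k) ≡ fω1 (i + p + k)) → 24 ∣ p
synchronised i p agree
  with t , r , r<24 , refl ← divMod24 i
  with t′ , r′ , r′<24 , e ← divMod24 (t * 24 + r + p) =
  [ (λ r≡r′ → block-shift {t} {t′} {r} {p} (subst (λ r′ → t′ * 24 + r′ ≡ t * 24 + r + p) (sym r≡r′) e))
  , (λ (k , k<16 , differs) → contradiction (agree k<16)
       (mismatch t 2 t′ 2 (sym (+-assoc (t * 24) r k)) (trans (sym (+-assoc (t′ * 24) r′ k)) (cong (_+ k) e))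
         differs))
  ]′ (windows-synchronised t t′ r<24 r′<24)

sixteen-agree : ∀ {k p} → k < 16 → 20 ≤ p → 4 * k ≤ 3 * p
sixteen-agree k<16 20≤p = ≤-trans (*-monoʳ-≤ 4 (≤-pred k<16)) (*-monoʳ-≤ 3 20≤p)

no-direct-repetition : ∀ p i → 0 < p → ¬ DirectRepetition fω1 p i
no-direct-repetition = <-rec _ step
  where
  step : ∀ p → (∀ {q} → q < p → ∀ i → 0 < q → ¬ DirectRepetition fω1 q i) →
         ∀ i → 0 < p → ¬ DirectRepetition fω1 p i
  step p rec i 0<p rep with p <? 20
  ... | yes p<20 = no-short-direct-repetition i 0<p p<20 rep
  ... | no p≮20 with synchronised i p (λ {k} k<16 → rep {k} (sixteen-agree k<16 (≮⇒≥ p≮20)))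
  ...   | divides (suc q) refl with t , r , r<24 , refl ← divMod24 i =
    rec (m<m*n (suc q) 24 (s≤s (s≤s z≤n))) t (s≤s z≤n) (desubstitute (suc q) t r<24 rep)

-- Reversed repetitions

mirrorBroken : Word → ℕ → ℕ → ℕ → ℕ → Bool
mirrorBroken L r m g a = differ L (r + a) L (r + m + g + (m ∸ suc a))

shortMirrorBrokenAt : Word → ℕ → ℕ → ℕ → Bool
shortMirrorBrokenAt L r m g = (m ≤ᵇ 3 * g) ∨ any (mirrorBroken L r m g) (upTo m)

shortMirrorsBroken : Word → Bool
shortMirrorsBroken L = all (λ r → all (λ m → all (shortMirrorBrokenAt L r m) (upTo 6)) (upTo 19)) (upTo 24)

short-mirrors-broken : T (allDistinctNeighbours 3 (shortMirrorsBroken ∘ f))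
short-mirrors-broken = tt

short-mirror-broken : ∀ t {r m g} → r < 24 → m < 19 → g < 6 →
  m ≤ 3 * g ⊎ ∃[ a ] a < m × T (mirrorBroken (f (factor fω1 t 3)) r m g a)
short-mirror-broken t {r} {m} {g} r<24 m<19 g<6 =
  [ inj₁ ∘ ≤ᵇ⇒≤ m (3 * g) , inj₂ ∘ any-upTo-sound (mirrorBroken L r m g) m ]′
    (Equivalence.to (T-∨ {m ≤ᵇ 3 * g}) (all-upTo-sound (shortMirrorBrokenAt L r m) 6
      (all-upTo-sound (λ m → all (shortMirrorBrokenAt L r m) (upTo 6)) 19
        (all-upTo-sound (λ r → all (λ m → all (shortMirrorBrokenAt L r m) (upTo 6)) (upTo 19)) 24
          (allDistinctNeighbours-factor 3 (shortMirrorsBroken ∘ f) short-mirrors-broken t) r<24) m<19) g<6))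
  where
  L : Word
  L = f (factor fω1 t 3)

no-short-mirror : ∀ i {m g} → m < 19 → 3 * g < m → ¬ Mirror fω1 i (i + m + g) m
no-short-mirror i {m} {g} m<19 3g<m mirror with t , r , r<24 , refl ← divMod24 i =
  [ <⇒≱ 3g<m
  , (λ (a , a<m , differs) → mismatch t 3 t 3 (sym (+-assoc (t * 24) r a)) (regroup (t * 24) r m g (m ∸ suc a)) differs
       (mirror (m+[n∸m]≡n a<m)))
  ]′ (short-mirror-broken t r<24 m<19 (*-cancelˡ-< 3 g 6 (<-≤-trans 3g<m (≤-pred m<19))))
  where
  regroup : ∀ a b c d e → a + (b + c + d + e) ≡ a + b + c + d + e
  regroup = solve-∀

mirror19BrokenAt : Word → Word → ℕ → ℕ → ℕ → Bool
mirror19BrokenAt L L′ r r′ a = differ L (r + a) L′ (r′ + (18 ∸ a))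

mirrors19Broken : Word → Word → Bool
mirrors19Broken L L′ = all (λ r → all (λ r′ → any (mirror19BrokenAt L L′ r r′) (upTo 19)) (upTo 24)) (upTo 24)

f-mirrors-19-broken : T (allDistinctNeighbours 2 λ u → allDistinctNeighbours 2 λ v → mirrors19Broken (f u) (f v))
f-mirrors-19-broken = tt

windows-mirror-19-broken : ∀ t t′ {r r′} → r < 24 → r′ < 24 →
  ∃[ a ] a < 19 × T (mirror19BrokenAt (f (factor fω1 t 2)) (f (factor fω1 t′ 2)) r r′ a)
windows-mirror-19-broken t t′ {r} {r′} r<24 r′<24 =
  any-upTo-sound (mirror19BrokenAt L L′ r r′) 19
    (all-upTo-sound (λ r′ → any (mirror19BrokenAt L L′ r r′) (upTo 19)) 24
      (all-upTo-sound (λ r → all (λ r′ → any (mirror19BrokenAt L L′ r r′) (upTo 19)) (upTo 24)) 24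
        (allDistinctNeighbours-factor 2 (mirrors19Broken L ∘ f)
          (allDistinctNeighbours-factor 2 (λ u → allDistinctNeighbours 2 λ v → mirrors19Broken (f u) (f v))
            f-mirrors-19-broken t) t′) r<24) r′<24)
  where
  L L′ : Word
  L = f (factor fω1 t 2)
  L′ = f (factor fω1 t′ 2)

no-mirror-19 : ∀ i j → ¬ Mirror fω1 i j 19
no-mirror-19 i j mirror
  with t , r , r<24 , refl ← divMod24 i
  with t′ , r′ , r′<24 , refl ← divMod24 j =
  let a , a<19 , differs = windows-mirror-19-broken t t′ r<24 r′<24 in
  mismatch t 2 t′ 2 (sym (+-assoc (t * 24) r a)) (sym (+-assoc (t′ * 24) r′ (18 ∸ a))) differs
    (mirror (m+[n∸m]≡n a<19))

no-mirrored-repetition : ∀ i m g → 3 * g < m → ¬ Mirror fω1 i (i + m + g) m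
no-mirrored-repetition i m g 3g<m mirror with <-or-offset 19 m
... | inj₁ m<19       = no-short-mirror i m<19 3g<m mirror
... | inj₂ (l , refl) = no-mirror-19 i (i + m + g + l) (Mirror-shrink fω1 {i} {i + m + g} {19} {l} mirror)

theorem2 : UndirectedFreePlus 7 4 fω1
theorem2 i n power =
  [ (λ (p , 0<p , rep) → no-direct-repetition p i 0<p rep)
  , (λ (m , g , 3g<m , mirror) → no-mirrored-repetition i m g 3g<m mirror)
  ]′ (power⇒repetition fω1 power)
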